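{- Let $N$ be a positive integer and for integers $0\le m,n\le N-1$ put $C_N(m,n)=\binom{n}{m}\big/\binom{N-1}{m}$. Then: (1) for integers $0<m<N$ and $0\le n\le n'<N$, \[\frac{1}{m}\bigl(C_N(m,n')-C_N(m,n)\bigr)=\sum_{b=n+1}^{n'}C_N(m,b)\frac{1}{b};\] (2) for integers $0\le m\le m'<N$ and $0<n<N$, \[\sum_{a=m+1}^{m'}C_N(a,n)\frac{1}{n}=\bigl(C_N(m,n-1)-C_N(m',n-1)\bigr)\frac{1}{N-n}.\]
   Context: $\binom{n}{m}=0$ when $n<m$. -}

module Defs where

open import Data.Nat using (ℕ; zero; suc; _∸_; _<ᵇ_)
open import Data.Bool using (true; false)
open import Data.Nat.Combinatorics using (_C_)
open import Data.Integer using (+_)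
open import Data.Rational using (ℚ; 0ℚ; _+_; _/_)

-- Quotient of two naturals as a rational; the value at denominator 0 is
-- an irrelevant convention (0) and is never used by the statement,
-- since all denominators occurring there are positive.
_÷ℕ_ : ℕ → ℕ → ℚ
a ÷ℕ zero  = 0ℚ
a ÷ℕ suc d = (+ a) / suc d

Cf : ℕ → ℕ → ℕ → ℚ
Cf N m n = (n C m) ÷ℕ ((N ∸ 1) C m)

-- Σ[ b = lo+1 .. hi ] f b  (empty when hi ≤ lo)
sumFromTo : ℕ → ℕ → (ℕ → ℚ) → ℚ
sumFromTo lo zero    f = 0ℚ
sumFromTo lo (suc k) f with lo <ᵇ suc k
... | true  = sumFromTo lo k f + f (suc k)
... | false = 0ℚ

-- Both identities telescope.  For (1), Pascal's rule and the absorption identity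
-- b·binom(b−1, m−1) = m·binom(b, m) give C(m,b)/b = (C(m,b) − C(m,b−1))/m.
-- For (2), the ratio identity (k+1)·binom(n, k+1) = (n−k)·binom(n, k), used in the
-- numerator and in the denominator binom(N−1, ·), shows that C(k+1,n)/n and
-- (C(k,n−1) − C(k+1,n−1))/(N−n) both equal C(k,n−1)/(N−1−k).
module Submission where

open import Defs
open import Data.Nat using (ℕ; _≤_; _<_; _∸_)
open import Data.Product using (_×_)
open import Relation.Binary.PropositionalEquality using (_≡_)
open import Data.Rational using (ℚ; _+_; _-_; _*_)

open import Data.Nat as ℕ using (zero; suc; z≤n; s≤s; z<s; _<ᵇ_)
open import Data.Nat.Properties
  using (*-identityˡ; *-identityʳ; +-identityʳ; *-zeroʳ; m≤m+n; <-≤-trans; ≤-pred; <⇒≤; n<1+n;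
         m<n⇒m<1+n; ≤∧≮⇒≡; m+[n∸m]≡n; m<n⇒0<n∸m; <ᵇ-reflects-<)
open import Data.Nat.Combinatorics using (_C_; nCk+nC[k+1]≡[n+1]C[k+1]; nC1≡n)
open import Data.Nat.Tactic.RingSolver using (solve-∀)
open import Data.Integer as ℤ using (+_)
import Data.Integer.Properties as ℤ
open import Data.Rational using (1ℚ; -_; _/_; fromℚᵘ)
open import Data.Rational.Properties using (fromℚᵘ-cong; fromℚᵘ-toℚᵘ; toℚᵘ-fromℚᵘ; toℚᵘ-homo-+; toℚᵘ-homo-*)
import Data.Rational.Properties as ℚ
import Data.Rational.Unnormalised as ℚᵘ
import Data.Rational.Unnormalised.Properties as ℚᵘ
open import Data.Rational.Solver using (module +-*-Solver)
open import Data.Product using (_,_)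
open import Data.Bool using (true; false)
open import Relation.Binary.PropositionalEquality using (refl; sym; trans; cong; cong₂; subst; module ≡-Reasoning)
open import Relation.Nullary.Reflects using (ofʸ; ofⁿ)

open +-*-Solver using (solve; con; _:+_; _:*_; _:-_; :-_; _:=_)
open ≡-Reasoning

k≤n⇒nCk>0 : ∀ {n k} → k ≤ n → 0 < n C k
k≤n⇒nCk>0 {n}     {zero}  _         = z<s
k≤n⇒nCk>0 {suc n} {suc k} (s≤s k≤n) =
  subst (0 <_) (nCk+nC[k+1]≡[n+1]C[k+1] n k) (<-≤-trans (k≤n⇒nCk>0 k≤n) (m≤m+n _ _))

[n+1]*nCk≡[k+1]*[n+1]C[k+1] : ∀ n k → suc n ℕ.* (n C k) ≡ suc k ℕ.* (suc n C suc k)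
[n+1]*nCk≡[k+1]*[n+1]C[k+1] n       zero    =
  trans (*-identityʳ (suc n)) (sym (trans (cong (ℕ._+ 0) (nC1≡n (suc n))) (+-identityʳ (suc n))))
[n+1]*nCk≡[k+1]*[n+1]C[k+1] zero    (suc k) = sym (*-zeroʳ (suc (suc k)))
[n+1]*nCk≡[k+1]*[n+1]C[k+1] (suc n) (suc k) = begin
  suc (suc n) ℕ.* (suc n C suc k)                            ≡⟨ cong (suc (suc n) ℕ.*_) (sym (pascal n k)) ⟩
  suc (suc n) ℕ.* (n C k ℕ.+ n C suc k)                      ≡⟨ split (n C k) (n C suc k) n ⟩
  suc n ℕ.* (n C k) ℕ.+ suc n ℕ.* (n C suc k) ℕ.+ (n C k ℕ.+ n C suc k)
    ≡⟨ cong₂ ℕ._+_ (cong₂ ℕ._+_ ([n+1]*nCk≡[k+1]*[n+1]C[k+1] n k) ([n+1]*nCk≡[k+1]*[n+1]C[k+1] n (suc k)))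
                   (pascal n k) ⟩
  suc k ℕ.* (suc n C suc k) ℕ.+ suc (suc k) ℕ.* (suc n C suc (suc k)) ℕ.+ suc n C suc k
    ≡⟨ merge (suc n C suc k) (suc n C suc (suc k)) k ⟩
  suc (suc k) ℕ.* (suc n C suc k ℕ.+ suc n C suc (suc k))    ≡⟨ cong (suc (suc k) ℕ.*_) (pascal (suc n) (suc k)) ⟩
  suc (suc k) ℕ.* (suc (suc n) C suc (suc k))                ∎
  where
  pascal = nCk+nC[k+1]≡[n+1]C[k+1]
  split : ∀ a b n → suc (suc n) ℕ.* (a ℕ.+ b) ≡ suc n ℕ.* a ℕ.+ suc n ℕ.* b ℕ.+ (a ℕ.+ b)
  split = solve-∀
  merge : ∀ c d k → suc k ℕ.* c ℕ.+ suc (suc k) ℕ.* d ℕ.+ c ≡ suc (suc k) ℕ.* (c ℕ.+ d)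
  merge = solve-∀

fromℚᵘ-homo-+ : ∀ p q → fromℚᵘ (p ℚᵘ.+ q) ≡ fromℚᵘ p + fromℚᵘ q
fromℚᵘ-homo-+ p q = trans
  (fromℚᵘ-cong (ℚᵘ.+-cong (ℚᵘ.≃-sym (toℚᵘ-fromℚᵘ p)) (ℚᵘ.≃-sym (toℚᵘ-fromℚᵘ q))))
  (trans (fromℚᵘ-cong (ℚᵘ.≃-sym (toℚᵘ-homo-+ (fromℚᵘ p) (fromℚᵘ q)))) (fromℚᵘ-toℚᵘ _))

fromℚᵘ-homo-* : ∀ p q → fromℚᵘ (p ℚᵘ.* q) ≡ fromℚᵘ p * fromℚᵘ q
fromℚᵘ-homo-* p q = trans
  (fromℚᵘ-cong (ℚᵘ.*-cong (ℚᵘ.≃-sym (toℚᵘ-fromℚᵘ p)) (ℚᵘ.≃-sym (toℚᵘ-fromℚᵘ q))))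
  (trans (fromℚᵘ-cong (ℚᵘ.≃-sym (toℚᵘ-homo-* (fromℚᵘ p) (fromℚᵘ q)))) (fromℚᵘ-toℚᵘ _))

fromℚᵘ-≡ : ∀ p q → ℚᵘ.↥ p ℤ.* ℚᵘ.↧ q ≡ ℚᵘ.↥ q ℤ.* ℚᵘ.↧ p → fromℚᵘ p ≡ fromℚᵘ q
fromℚᵘ-≡ p q eq = fromℚᵘ-cong {p} {q} (ℚᵘ.*≡* eq)

ι : ℕ → ℚ
ι n = + n / 1

ι-+ : ∀ m n → ι (m ℕ.+ n) ≡ ι m + ι n
ι-+ m n = trans
  (fromℚᵘ-≡ (ℚᵘ.mkℚᵘ (+ (m ℕ.+ n)) 0) (ℚᵘ.mkℚᵘ (+ m) 0 ℚᵘ.+ ℚᵘ.mkℚᵘ (+ n) 0)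
    (cong (ℤ._* + 1) (trans (ℤ.pos-+ m n) (cong₂ ℤ._+_ (sym (ℤ.*-identityʳ (+ m))) (sym (ℤ.*-identityʳ (+ n)))))))
  (fromℚᵘ-homo-+ (ℚᵘ.mkℚᵘ (+ m) 0) (ℚᵘ.mkℚᵘ (+ n) 0))

ι-* : ∀ m n → ι (m ℕ.* n) ≡ ι m * ι n
ι-* m n = trans
  (fromℚᵘ-≡ (ℚᵘ.mkℚᵘ (+ (m ℕ.* n)) 0) (ℚᵘ.mkℚᵘ (+ m) 0 ℚᵘ.* ℚᵘ.mkℚᵘ (+ n) 0) (cong (ℤ._* + 1) (ℤ.pos-* m n)))
  (fromℚᵘ-homo-* (ℚᵘ.mkℚᵘ (+ m) 0) (ℚᵘ.mkℚᵘ (+ n) 0))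

ι-∸ : ∀ {m n} → m ≤ n → ι (n ∸ m) ≡ ι n - ι m
ι-∸ {m} {n} m≤n = begin
  ι (n ∸ m)                ≡⟨ add-sub (ι (n ∸ m)) (ι m) ⟩
  (ι m + ι (n ∸ m)) - ι m  ≡⟨ cong (_- ι m) (sym (ι-+ m (n ∸ m))) ⟩
  ι (m ℕ.+ (n ∸ m)) - ι m  ≡⟨ cong (λ k → ι k - ι m) (m+[n∸m]≡n m≤n) ⟩
  ι n - ι m                ∎
  where
  add-sub : ∀ x y → x ≡ (y + x) - y
  add-sub = solve 2 (λ x y → x := (y :+ x) :- y) refl

÷ℕ-as-* : ∀ a d → a ÷ℕ d ≡ ι a * (1 ÷ℕ d)
÷ℕ-as-* a zero    = sym (ℚ.*-zeroʳ (ι a))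
÷ℕ-as-* a (suc d) = trans
  (fromℚᵘ-≡ (ℚᵘ.mkℚᵘ (+ a) d) (ℚᵘ.mkℚᵘ (+ a) 0 ℚᵘ.* ℚᵘ.mkℚᵘ (+ 1) d)
    (cong₂ ℤ._*_ (sym (ℤ.*-identityʳ (+ a))) (cong +_ (*-identityˡ (suc d)))))
  (fromℚᵘ-homo-* (ℚᵘ.mkℚᵘ (+ a) 0) (ℚᵘ.mkℚᵘ (+ 1) d))

ι-*-1÷ℕ : ∀ {d} → 0 < d → ι d * (1 ÷ℕ d) ≡ 1ℚ
ι-*-1÷ℕ {suc d} _ = trans (sym (÷ℕ-as-* (suc d) (suc d)))
  (fromℚᵘ-≡ (ℚᵘ.mkℚᵘ (+ suc d) d) (ℚᵘ.mkℚᵘ (+ 1) 0) (ℤ.*-comm (+ suc d) (+ 1)))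

ι[n+1]*ιnCk≡ι[k+1]*ι[n+1]C[k+1] : ∀ n k → ι (suc n) * ι (n C k) ≡ ι (suc k) * ι (suc n C suc k)
ι[n+1]*ιnCk≡ι[k+1]*ι[n+1]C[k+1] n k = begin
  ι (suc n) * ι (n C k)                  ≡⟨ sym (ι-* (suc n) (n C k)) ⟩
  ι (suc n ℕ.* (n C k))                  ≡⟨ cong ι ([n+1]*nCk≡[k+1]*[n+1]C[k+1] n k) ⟩
  ι (suc k ℕ.* (suc n C suc k))          ≡⟨ ι-* (suc k) (suc n C suc k) ⟩
  ι (suc k) * ι (suc n C suc k)          ∎

ι[k+1]*ιnC[k+1]≡[ιn-ιk]*ιnCk : ∀ n k → ι (suc k) * ι (n C suc k) ≡ (ι n - ι k) * ι (n C k)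
ι[k+1]*ιnC[k+1]≡[ιn-ιk]*ιnCk n k = begin
  ι (suc k) * y                            ≡⟨ split (ι (suc k)) x y ⟩
  ι (suc k) * (x + y) - ι (suc k) * x      ≡⟨ cong (_- ι (suc k) * x) absorb ⟩
  ι (suc n) * x - ι (suc k) * x            ≡⟨ cong₂ (λ a b → a * x - b * x) (ι-+ 1 n) (ι-+ 1 k) ⟩
  (1ℚ + ι n) * x - (1ℚ + ι k) * x          ≡⟨ cancel x (ι n) (ι k) ⟩
  (ι n - ι k) * x                          ∎
  where
  x = ι (n C k)
  y = ι (n C suc k)
  absorb : ι (suc k) * (x + y) ≡ ι (suc n) * x
  absorb = begin
    ι (suc k) * (x + y)                    ≡⟨ cong (ι (suc k) *_) (sym (ι-+ (n C k) (n C suc k))) ⟩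
    ι (suc k) * ι (n C k ℕ.+ n C suc k)    ≡⟨ cong (λ c → ι (suc k) * ι c) (nCk+nC[k+1]≡[n+1]C[k+1] n k) ⟩
    ι (suc k) * ι (suc n C suc k)          ≡⟨ sym (ι[n+1]*ιnCk≡ι[k+1]*ι[n+1]C[k+1] n k) ⟩
    ι (suc n) * x                          ∎
  split : ∀ a x y → a * y ≡ a * (x + y) - a * x
  split = solve 3 (λ a x y → a :* y := a :* (x :+ y) :- a :* x) refl
  cancel : ∀ x n k → (1ℚ + n) * x - (1ℚ + k) * x ≡ (n - k) * x
  cancel = solve 3 (λ x n k → (con 1ℚ :+ n) :* x :- (con 1ℚ :+ k) :* x := (n :- k) :* x) refl

*-distribˡ-− : ∀ a x y → a * (x - y) ≡ a * x - a * y
*-distribˡ-− a x y = trans (ℚ.*-distribˡ-+ a x (- y)) (cong (λ z → a * x + z) (sym (ℚ.neg-distribʳ-* a y)))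

*-distribʳ-− : ∀ a x y → (x - y) * a ≡ x * a - y * a
*-distribʳ-− a x y = trans (ℚ.*-distribʳ-+ a x (- y)) (cong (λ z → x * a + z) (sym (ℚ.neg-distribˡ-* y a)))

cross-multiply : ∀ d e x y → 0 < d → 0 < e → ι e * x ≡ ι d * y → x * (1 ÷ℕ d) ≡ (1 ÷ℕ e) * y
cross-multiply d e x y 0<d 0<e ex≡dy = begin
  x * d′                ≡⟨ sym (ℚ.*-identityˡ (x * d′)) ⟩
  1ℚ * (x * d′)         ≡⟨ cong (_* (x * d′)) (sym (ι-*-1÷ℕ 0<e)) ⟩
  (ι e * e′) * (x * d′) ≡⟨ regroup (ι e) e′ x d′ ⟩
  e′ * (ι e * x) * d′   ≡⟨ cong (λ z → e′ * z * d′) ex≡dy ⟩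
  e′ * (ι d * y) * d′   ≡⟨ regroup′ (ι d) d′ e′ y ⟩
  (ι d * d′) * (e′ * y) ≡⟨ cong (_* (e′ * y)) (ι-*-1÷ℕ 0<d) ⟩
  1ℚ * (e′ * y)         ≡⟨ ℚ.*-identityˡ (e′ * y) ⟩
  e′ * y                ∎
  where
  d′ = 1 ÷ℕ d
  e′ = 1 ÷ℕ e
  regroup : ∀ b b′ x a′ → (b * b′) * (x * a′) ≡ b′ * (b * x) * a′
  regroup = solve 4 (λ b b′ x a′ → (b :* b′) :* (x :* a′) := b′ :* (b :* x) :* a′) refl
  regroup′ : ∀ a a′ b′ y → b′ * (a * y) * a′ ≡ (a * a′) * (b′ * y)
  regroup′ = solve 4 (λ a a′ b′ y → b′ :* (a :* y) :* a′ := (a :* a′) :* (b′ :* y)) refl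

telescope : ∀ (f G : ℕ → ℚ) {lo} hi → lo ≤ hi →
            (∀ k → lo ≤ k → k < hi → f (suc k) ≡ G (suc k) - G k) →
            sumFromTo lo hi f ≡ G hi - G lo
telescope f G zero z≤n _ = sym (ℚ.+-inverseʳ (G 0))
telescope f G {lo} (suc k) lo≤hi step with lo <ᵇ suc k | <ᵇ-reflects-< lo (suc k)
... | true  | ofʸ lo<hi = begin
  sumFromTo lo k f + f (suc k)      ≡⟨ cong₂ _+_ (telescope f G k lo≤k (λ j p q → step j p (m<n⇒m<1+n q)))
                                                (step k lo≤k (n<1+n k)) ⟩
  (G k - G lo) + (G (suc k) - G k)  ≡⟨ collapse (G lo) (G k) (G (suc k)) ⟩
  G (suc k) - G lo                  ∎
  where
  lo≤k = ≤-pred lo<hi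
  collapse : ∀ x y z → (y - x) + (z - y) ≡ z - x
  collapse = solve 3 (λ x y z → (y :- x) :+ (z :- y) := z :- x) refl
... | false | ofⁿ lo≮hi =
  sym (trans (cong (λ j → G (suc k) - G j) (≤∧≮⇒≡ lo≤hi lo≮hi)) (ℚ.+-inverseʳ (G (suc k))))

telescope-down : ∀ (f G : ℕ → ℚ) {lo} hi → lo ≤ hi →
                 (∀ k → lo ≤ k → k < hi → f (suc k) ≡ G k - G (suc k)) →
                 sumFromTo lo hi f ≡ G lo - G hi
telescope-down f G hi lo≤hi step = trans
  (telescope f (λ b → - G b) hi lo≤hi (λ k p q → trans (step k p q) (flip (G k) (G (suc k)))))
  (sym (flip _ (G hi)))
  where
  flip : ∀ x y → x - y ≡ - y - - x
  flip = solve 2 (λ x y → x :- y := :- y :- :- x) refl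

Cf-as-* : ∀ N a b → Cf N a b ≡ ι (b C a) * (1 ÷ℕ ((N ∸ 1) C a))
Cf-as-* N a b = ÷ℕ-as-* (b C a) ((N ∸ 1) C a)

Cf[m,k+1]/[k+1]≡ΔCf/m : ∀ N {m} k → 0 < m →
  Cf N m (suc k) * (1 ÷ℕ suc k) ≡ (1 ÷ℕ m) * (Cf N m (suc k) - Cf N m k)
Cf[m,k+1]/[k+1]≡ΔCf/m N {suc m} k _ =
  cross-multiply (suc k) (suc m) (Cf N (suc m) (suc k)) (Cf N (suc m) (suc k) - Cf N (suc m) k)
    z<s z<s m*Cf≡[k+1]*ΔCf
  where
  κ = 1 ÷ℕ ((N ∸ 1) C suc m)
  ΔCf≡ : Cf N (suc m) (suc k) - Cf N (suc m) k ≡ ι (k C m) * κ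
  ΔCf≡ = begin
    Cf N (suc m) (suc k) - Cf N (suc m) k            ≡⟨ cong₂ _-_ (Cf-as-* N (suc m) (suc k)) (Cf-as-* N (suc m) k) ⟩
    ι (suc k C suc m) * κ - ι (k C suc m) * κ        ≡⟨ cong (λ c → ι c * κ - ι (k C suc m) * κ)
                                                              (sym (nCk+nC[k+1]≡[n+1]C[k+1] k m)) ⟩
    ι (k C m ℕ.+ k C suc m) * κ - ι (k C suc m) * κ  ≡⟨ cong (λ c → c * κ - ι (k C suc m) * κ) (ι-+ (k C m) (k C suc m)) ⟩
    (ι (k C m) + ι (k C suc m)) * κ - ι (k C suc m) * κ ≡⟨ cancel (ι (k C m)) (ι (k C suc m)) κ ⟩
    ι (k C m) * κ                                    ∎
    where
    cancel : ∀ x y κ → (x + y) * κ - y * κ ≡ x * κ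
    cancel = solve 3 (λ x y κ → (x :+ y) :* κ :- y :* κ := x :* κ) refl
  m*Cf≡[k+1]*ΔCf : ι (suc m) * Cf N (suc m) (suc k) ≡ ι (suc k) * (Cf N (suc m) (suc k) - Cf N (suc m) k)
  m*Cf≡[k+1]*ΔCf = begin
    ι (suc m) * Cf N (suc m) (suc k)       ≡⟨ cong (ι (suc m) *_) (Cf-as-* N (suc m) (suc k)) ⟩
    ι (suc m) * (ι (suc k C suc m) * κ)    ≡⟨ sym (ℚ.*-assoc (ι (suc m)) _ κ) ⟩
    ι (suc m) * ι (suc k C suc m) * κ      ≡⟨ cong (_* κ) (sym (ι[n+1]*ιnCk≡ι[k+1]*ι[n+1]C[k+1] k m)) ⟩
    ι (suc k) * ι (k C m) * κ              ≡⟨ ℚ.*-assoc (ι (suc k)) (ι (k C m)) κ ⟩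
    ι (suc k) * (ι (k C m) * κ)            ≡⟨ cong (ι (suc k) *_) (sym ΔCf≡) ⟩
    ι (suc k) * (Cf N (suc m) (suc k) - Cf N (suc m) k) ∎

ι[M-k]*Cf[k+1,b]≡α*Cf[k,b′] : ∀ {M k} b b′ α → k < M → ι (suc k) * ι (b C suc k) ≡ α * ι (b′ C k) →
  ι (M ∸ k) * Cf (suc M) (suc k) b ≡ α * Cf (suc M) k b′
ι[M-k]*Cf[k+1,b]≡α*Cf[k,b′] {M} {k} b b′ α k<M ratio = begin
  ι (M ∸ k) * Cf (suc M) (suc k) b   ≡⟨ cong (ι (M ∸ k) *_) (Cf-as-* (suc M) (suc k) b) ⟩
  E * (p * P′)                       ≡⟨ sym (ℚ.*-assoc E p P′) ⟩
  (E * p) * P′                       ≡⟨ cross-multiply (M C suc k) (M C k) (E * p) (α * q)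
                                          (k≤n⇒nCk>0 k<M) (k≤n⇒nCk>0 (<⇒≤ k<M)) Q[Ep]≡P[αq] ⟩
  Q′ * (α * q)                       ≡⟨ regroup Q′ α q ⟩
  α * (q * Q′)                       ≡⟨ cong (α *_) (sym (Cf-as-* (suc M) k b′)) ⟩
  α * Cf (suc M) k b′                ∎
  where
  E = ι (M ∸ k)
  p = ι (b C suc k)
  q = ι (b′ C k)
  P = ι (M C suc k)
  Q = ι (M C k)
  P′ = 1 ÷ℕ (M C suc k)
  Q′ = 1 ÷ℕ (M C k)
  c = ι (suc k)
  cP≡EQ : c * P ≡ E * Q
  cP≡EQ = trans (ι[k+1]*ιnC[k+1]≡[ιn-ιk]*ιnCk M k) (cong (_* Q) (sym (ι-∸ (<⇒≤ k<M))))
  Q[Ep]≡P[αq] : Q * (E * p) ≡ P * (α * q)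
  Q[Ep]≡P[αq] = begin
    Q * (E * p)   ≡⟨ sym (trans (cong (_* p) (ℚ.*-comm E Q)) (ℚ.*-assoc Q E p)) ⟩
    (E * Q) * p   ≡⟨ cong (_* p) (sym cP≡EQ) ⟩
    (c * P) * p   ≡⟨ trans (cong (_* p) (ℚ.*-comm c P)) (ℚ.*-assoc P c p) ⟩
    P * (c * p)   ≡⟨ cong (P *_) ratio ⟩
    P * (α * q)   ∎
  regroup : ∀ Q′ α q → Q′ * (α * q) ≡ α * (q * Q′)
  regroup = solve 3 (λ Q′ α q → Q′ :* (α :* q) := α :* (q :* Q′)) refl

Cf[k+1,n+1]/[n+1]≡ΔCf/[M-n] : ∀ {M k n} → k < M → n < M →
  Cf (suc M) (suc k) (suc n) * (1 ÷ℕ suc n) ≡ (Cf (suc M) k n - Cf (suc M) (suc k) n) * (1 ÷ℕ (M ∸ n))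
Cf[k+1,n+1]/[n+1]≡ΔCf/[M-n] {M} {k} {n} k<M n<M = begin
  u * (1 ÷ℕ suc n)            ≡⟨ cross-multiply (suc n) (M ∸ k) u v z<s 0<M-k Eu≡[n+1]v ⟩
  (1 ÷ℕ (M ∸ k)) * v          ≡⟨ sym (cross-multiply (M ∸ n) (M ∸ k) (v - w) v
                                         (m<n⇒0<n∸m n<M) 0<M-k E[v-w]≡[M-n]v) ⟩
  (v - w) * (1 ÷ℕ (M ∸ n))    ∎
  where
  u = Cf (suc M) (suc k) (suc n)
  v = Cf (suc M) k n
  w = Cf (suc M) (suc k) n
  E = ι (M ∸ k)
  0<M-k = m<n⇒0<n∸m k<M
  Eu≡[n+1]v : E * u ≡ ι (suc n) * v
  Eu≡[n+1]v = ι[M-k]*Cf[k+1,b]≡α*Cf[k,b′] (suc n) n (ι (suc n)) k<M (sym (ι[n+1]*ιnCk≡ι[k+1]*ι[n+1]C[k+1] n k))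
  Ew≡[n-k]v : E * w ≡ (ι n - ι k) * v
  Ew≡[n-k]v = ι[M-k]*Cf[k+1,b]≡α*Cf[k,b′] n n (ι n - ι k) k<M (ι[k+1]*ιnC[k+1]≡[ιn-ιk]*ιnCk n k)
  E[v-w]≡[M-n]v : E * (v - w) ≡ ι (M ∸ n) * v
  E[v-w]≡[M-n]v = begin
    E * (v - w)                         ≡⟨ *-distribˡ-− E v w ⟩
    E * v - E * w                       ≡⟨ cong₂ (λ a b → a * v - b) (ι-∸ (<⇒≤ k<M)) Ew≡[n-k]v ⟩
    (ι M - ι k) * v - (ι n - ι k) * v   ≡⟨ cancel (ι M) (ι n) (ι k) v ⟩
    (ι M - ι n) * v                     ≡⟨ cong (_* v) (sym (ι-∸ (<⇒≤ n<M))) ⟩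
    ι (M ∸ n) * v                       ∎
    where
    cancel : ∀ M n k v → (M - k) * v - (n - k) * v ≡ (M - n) * v
    cancel = solve 4 (λ M n k v → (M :- k) :* v :- (n :- k) :* v := (M :- n) :* v) refl

sum-Cf/b : ∀ N {m n n′} → 0 < m → n ≤ n′ →
  sumFromTo n n′ (λ b → Cf N m b * (1 ÷ℕ b)) ≡ (1 ÷ℕ m) * (Cf N m n′ - Cf N m n)
sum-Cf/b N {m} {n} {n′} 0<m n≤n′ = begin
  sumFromTo n n′ (λ b → Cf N m b * (1 ÷ℕ b))  ≡⟨ telescope _ G n′ n≤n′ (λ k _ _ → step k) ⟩
  G n′ - G n                                  ≡⟨ sym (*-distribˡ-− (1 ÷ℕ m) (Cf N m n′) (Cf N m n)) ⟩
  (1 ÷ℕ m) * (Cf N m n′ - Cf N m n)           ∎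
  where
  G : ℕ → ℚ
  G b = (1 ÷ℕ m) * Cf N m b
  step : ∀ k → Cf N m (suc k) * (1 ÷ℕ suc k) ≡ G (suc k) - G k
  step k = trans (Cf[m,k+1]/[k+1]≡ΔCf/m N k 0<m) (*-distribˡ-− (1 ÷ℕ m) (Cf N m (suc k)) (Cf N m k))

sum-Cf/n : ∀ N {m m′ n} → m ≤ m′ → m′ < N → 0 < n → n < N →
  sumFromTo m m′ (λ a → Cf N a n * (1 ÷ℕ n)) ≡ (Cf N m (n ∸ 1) - Cf N m′ (n ∸ 1)) * (1 ÷ℕ (N ∸ n))
sum-Cf/n (suc M) {m} {m′} {suc n} m≤m′ (s≤s m′≤M) _ (s≤s n<M) = begin
  sumFromTo m m′ (λ a → Cf (suc M) a (suc n) * (1 ÷ℕ suc n))  ≡⟨ telescope-down _ G m′ m≤m′ step ⟩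
  G m - G m′                                                  ≡⟨ sym (*-distribʳ-− D (Cf (suc M) m n) (Cf (suc M) m′ n)) ⟩
  (Cf (suc M) m n - Cf (suc M) m′ n) * D                      ∎
  where
  D = 1 ÷ℕ (M ∸ n)
  G : ℕ → ℚ
  G a = Cf (suc M) a n * D
  step : ∀ k → m ≤ k → k < m′ → Cf (suc M) (suc k) (suc n) * (1 ÷ℕ suc n) ≡ G k - G (suc k)
  step k _ k<m′ = trans (Cf[k+1,n+1]/[n+1]≡ΔCf/[M-n] (<-≤-trans k<m′ m′≤M) n<M)
                        (*-distribʳ-− D (Cf (suc M) k n) (Cf (suc M) (suc k) n))

lemma3p8 : (N : ℕ) → 0 < N →
    ((m n n′ : ℕ) → 0 < m → m < N → n ≤ n′ → n′ < N →
    (1 ÷ℕ m) * (Cf N m n′ - Cf N m n)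
    ≡ sumFromTo n n′ (λ b → Cf N m b * (1 ÷ℕ b)))
    × ((m m′ n : ℕ) → m ≤ m′ → m′ < N → 0 < n → n < N →
    sumFromTo m m′ (λ a → Cf N a n * (1 ÷ℕ n))
    ≡ (Cf N m (n ∸ 1) - Cf N m′ (n ∸ 1)) * (1 ÷ℕ (N ∸ n)))
lemma3p8 N _ =
  (λ m n n′ 0<m _ n≤n′ _ → sym (sum-Cf/b N 0<m n≤n′)) ,
  (λ m m′ n m≤m′ m′<N 0<n n<N → sum-Cf/n N m≤m′ m′<N 0<n n<N)
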